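{- Let $N\ge 2$ be an integer, let $H\subseteq\binom{[N]}{2}$ be any set of $2$-element subsets of $[N]=\{1,\dots,N\}$ with $|H|=\frac12\binom N2$, and let $k=\lfloor N/2\rfloor$. Then there exists a subset $S\subseteq[N]$ with $|S|=k$ such that the number of pairs $e\in H$ with $e\cap S\neq\emptyset$ is at least $\left\lceil\frac{2kN-k^2-k}{4}\right\rceil$.
   Context: $\binom{[N]}{2}$ denotes the set of all $2$-element subsets of $[N]$. -}

module Defs where

open import Data.Nat using (ℕ; _+_; _*_; _∸_; _/_)
open import Data.Bool using (Bool; _∨_; T)
open import Data.Bool.Properties using (T?)
open import Data.Fin using (Fin)
open import Data.Fin.Subset using (Subset)
open import Data.Vec using (lookup)
open import Data.Product using (_×_; _,_)
open import Data.List using (List; filter; length)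

-- A 2-element subset {i, j} of [N] = Fin N is represented canonically as
-- an ordered pair (i , j) with i < j.
Pair : ℕ → Set
Pair N = Fin N × Fin N

meets : ∀ {N} → Subset N → Pair N → Bool
meets S (i , j) = lookup S i ∨ lookup S j

hitCount : ∀ {N} → Subset N → List (Pair N) → ℕ
hitCount S H = length (filter (λ e → T? (meets S e)) H)

ceil/4 : ℕ → ℕ
ceil/4 x = (x + 3) / 4

module Submission where

-- Grow S greedily, always adding an outside vertex of largest degree in the graph of pairs
-- not yet met.  By the handshake lemma that degree is at least twice the number r of such
-- pairs divided by the number n of outside vertices, and this is exactly what keeps their
-- density r / (n (n - 1)) from increasing.  Starting from density 1/4, after k steps at most
-- (N - k)(N - k - 1)/4 pairs are missed, and the rest is arithmetic.

open import Defs
open import Data.Nat using (ℕ; zero; suc; _+_; _*_; _∸_; _≤_; z≤n; s≤s; ⌊_/2⌋)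
open import Data.Nat.Properties
open import Data.Nat.Combinatorics using (_C_; nCk+nC[k+1]≡[n+1]C[k+1]; nC1≡n)
open import Data.Nat.DivMod using (m<n*o⇒m/o<n)
open import Data.Nat.Tactic.RingSolver using (solve-∀)
open import Data.Bool using (Bool; true; false; not; _∧_; _∨_)
open import Data.Bool.Properties using (∨-commutativeMonoid; ∨-zeroʳ; ∧-zeroʳ)
open import Data.Fin using (Fin; zero; suc) renaming (_<_ to _<ᶠ_)
open import Data.Fin.Properties using () renaming (<⇒≢ to <ᶠ⇒≢)
open import Data.Fin.Subset
  using (Subset; inside; outside; ∣_∣; _∈_; _∉_; _⊆_; _∪_; ⁅_⁆; ∁; ⊥; Nonempty)
open import Data.Fin.Subset.Properties
  using (_∈?_; nonempty?; Empty-unique; ∣⊥∣≡0; ∪-identityʳ; x∈⁅y⁆⇒x≡y; ∣∁p∣≡n∸∣p∣;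
         x∈∁p⇒x∉p; x∉∁p⇒x∈p)
open import Data.Vec using (lookup; _∷_; []; here; there)
open import Data.Vec.Properties using (lookup-zipWith; lookup-replicate; []=⇒lookup; lookup⇒[]=)
open import Data.List using (List; []; _∷_; length; filter; filterᵇ; allFin)
open import Data.List.Relation.Unary.All as All using (All)
open import Data.List.Relation.Unary.All.Properties using (all-filter)
open import Data.List.Relation.Unary.Unique.Propositional using (Unique)
open import Data.List.Membership.Propositional.Properties using (∈-filter⁺; ∈-allFin)
open import Data.List.Extrema.Nat using (argmax; argmax-all; f[xs]≤f[argmax])
open import Data.Product using (Σ; Σ-syntax; _×_; _,_; proj₁; proj₂)
open import Function using (_∘_)
open import Relation.Nullary using (yes; no; contradiction)
open import Relation.Binary.PropositionalEquality
  using (_≡_; _≢_; _≗_; refl; sym; trans; cong; cong₂; subst; subst₂; module ≡-Reasoning)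
open import Algebra.Bundles using (CommutativeMonoid)
open import Algebra.Properties.CommutativeMonoid.Sum +-0-commutativeMonoid
  using (sum-syntax; ∑-distrib-+; sum-cong-≗; sum-replicate-zero)
open import Algebra.Properties.CommutativeSemigroup +-commutativeSemigroup
  using () renaming (interchange to +-interchange)
open import Algebra.Properties.CommutativeSemigroup
  (CommutativeMonoid.commutativeSemigroup ∨-commutativeMonoid)
  using () renaming (interchange to ∨-interchange)

private
  variable
    A : Set
    N : ℕ

⟦_⟧ : Bool → ℕ
⟦ true ⟧ = 1
⟦ false ⟧ = 0

count : (A → Bool) → List A → ℕ
count p [] = 0
count p (x ∷ xs) = ⟦ p x ⟧ + count p xs

length-filterᵇ : (p : A → Bool) (xs : List A) → length (filterᵇ p xs) ≡ count p xs
length-filterᵇ p [] = refl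
length-filterᵇ p (x ∷ xs) with p x
... | true = cong suc (length-filterᵇ p xs)
... | false = length-filterᵇ p xs

count-cong : {p q : A → Bool} → p ≗ q → (xs : List A) → count p xs ≡ count q xs
count-cong p≗q [] = refl
count-cong p≗q (x ∷ xs) = cong₂ _+_ (cong ⟦_⟧ (p≗q x)) (count-cong p≗q xs)

count-true : (xs : List A) → count (λ _ → true) xs ≡ length xs
count-true [] = refl
count-true (x ∷ xs) = cong suc (count-true xs)

count-false : (xs : List A) → count (λ _ → false) xs ≡ 0
count-false [] = refl
count-false (x ∷ xs) = count-false xs

count-∧-split : (p q : A → Bool) (xs : List A) →
  count (λ x → p x ∧ q x) xs + count (λ x → p x ∧ not (q x)) xs ≡ count p xs
count-∧-split p q [] = refl
count-∧-split p q (x ∷ xs) = begin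
  (⟦ p x ∧ q x ⟧ + count pq xs) + (⟦ p x ∧ not (q x) ⟧ + count p¬q xs)
    ≡⟨ +-interchange ⟦ pq x ⟧ (count pq xs) ⟦ p¬q x ⟧ (count p¬q xs) ⟩
  (⟦ p x ∧ q x ⟧ + ⟦ p x ∧ not (q x) ⟧) + (count pq xs + count p¬q xs)
    ≡⟨ cong₂ _+_ (split (p x) (q x)) (count-∧-split p q xs) ⟩
  ⟦ p x ⟧ + count p xs ∎
  where
  open ≡-Reasoning
  pq p¬q : _ → Bool
  pq x = p x ∧ q x
  p¬q x = p x ∧ not (q x)
  split : ∀ a b → ⟦ a ∧ b ⟧ + ⟦ a ∧ not b ⟧ ≡ ⟦ a ⟧
  split true true = refl
  split true false = refl
  split false b = refl

count-complement : (p : A → Bool) (xs : List A) → count p xs + count (not ∘ p) xs ≡ length xs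
count-complement p xs = trans (count-∧-split (λ _ → true) p xs) (count-true xs)

∑≤∣p∣* : (p : Subset N) (f : Fin N → ℕ) {M : ℕ} →
  (∀ {v} → v ∉ p → f v ≡ 0) → (∀ {v} → v ∈ p → f v ≤ M) → ∑[ v < N ] f v ≤ ∣ p ∣ * M
∑≤∣p∣* [] f off on = z≤n
∑≤∣p∣* (inside ∷ p) f off on =
  +-mono-≤ (on here) (∑≤∣p∣* p (f ∘ suc) (λ v∉p → off λ { (there v∈p) → v∉p v∈p }) (on ∘ there))
∑≤∣p∣* (outside ∷ p) f off on rewrite off {zero} (λ ()) =
  ∑≤∣p∣* p (f ∘ suc) (λ v∉p → off λ { (there v∈p) → v∉p v∈p }) (on ∘ there)

argmax-on : (p : Subset N) (f : Fin N → ℕ) → Nonempty p →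
  Σ[ u ∈ Fin N ] u ∈ p × (∀ {w} → w ∈ p → f w ≤ f u)
argmax-on {N} p f (v , v∈p) =
  u , argmax-all f v∈p (all-filter (_∈? p) (allFin N)) ,
  λ {w} w∈p → All.lookup (f[xs]≤f[argmax] v members) (∈-filter⁺ (_∈? p) (∈-allFin w) w∈p)
  where
  members = filter (_∈? p) (allFin N)
  u = argmax f v members

∃-above-average : (p : Subset N) (f : Fin N → ℕ) → Nonempty p → (∀ {v} → v ∉ p → f v ≡ 0) →
  Σ[ u ∈ Fin N ] u ∈ p × ∑[ v < N ] f v ≤ ∣ p ∣ * f u
∃-above-average p f ne off with argmax-on p f ne
... | u , u∈p , max = u , u∈p , ∑≤∣p∣* p f off max

∣p∣≡1+n⇒Nonempty : {p : Subset N} {n : ℕ} → ∣ p ∣ ≡ suc n → Nonempty p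
∣p∣≡1+n⇒Nonempty {N} {p} ∣p∣≡1+n with nonempty? p
... | yes ne = ne
... | no empty = contradiction (trans (sym ∣p∣≡1+n) (trans (cong ∣_∣ (Empty-unique empty)) (∣⊥∣≡0 N))) λ ()

Loopless : List (Pair N) → Set
Loopless = All (λ e → proj₁ e ≢ proj₂ e)

meets-⊥ : (e : Pair N) → meets ⊥ e ≡ false
meets-⊥ (i , j) rewrite lookup-replicate i outside | lookup-replicate j outside = refl

lookup-mono : {p q : Subset N} → p ⊆ q → ∀ i → lookup p i ≡ true → lookup q i ≡ true
lookup-mono p⊆q i pᵢ = []=⇒lookup (p⊆q (lookup⇒[]= i _ pᵢ))

meets-mono : {p q : Subset N} → p ⊆ q → ∀ e → meets p e ≡ true → meets q e ≡ true
meets-mono {p = p} p⊆q (i , j) hit with lookup p i in pᵢ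
... | true rewrite lookup-mono p⊆q i pᵢ = refl
... | false rewrite lookup-mono p⊆q j hit = ∨-zeroʳ _

meets-∪ : (p q : Subset N) → ∀ e → meets (p ∪ q) e ≡ meets p e ∨ meets q e
meets-∪ p q (i , j) rewrite lookup-zipWith _∨_ i p q | lookup-zipWith _∨_ j p q =
  ∨-interchange (lookup p i) (lookup q i) (lookup p j) (lookup q j)

lookup-⁅⁆ : (v i : Fin N) → lookup ⁅ v ⁆ i ≡ true → i ≡ v
lookup-⁅⁆ v i hit = x∈⁅y⁆⇒x≡y v (lookup⇒[]= i ⁅ v ⁆ hit)

∑-lookup-⁅⁆ : (i : Fin N) → ∑[ v < N ] ⟦ lookup ⁅ v ⁆ i ⟧ ≡ 1
∑-lookup-⁅⁆ {suc N} zero = cong suc (sum-replicate-zero N)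
∑-lookup-⁅⁆ {suc N} (suc i) rewrite lookup-replicate i outside = ∑-lookup-⁅⁆ i

∑-meets-⁅⁆ : {i j : Fin N} → i ≢ j → ∑[ v < N ] ⟦ meets ⁅ v ⁆ (i , j) ⟧ ≡ 2
∑-meets-⁅⁆ {N} {i} {j} i≢j = begin
  ∑[ v < N ] ⟦ lookup ⁅ v ⁆ i ∨ lookup ⁅ v ⁆ j ⟧
    ≡⟨ sum-cong-≗ (λ v → ⟦∨⟧ (lookup ⁅ v ⁆ i) (lookup ⁅ v ⁆ j) (not-both v)) ⟩
  ∑[ v < N ] (⟦ lookup ⁅ v ⁆ i ⟧ + ⟦ lookup ⁅ v ⁆ j ⟧)
    ≡⟨ ∑-distrib-+ (λ v → ⟦ lookup ⁅ v ⁆ i ⟧) (λ v → ⟦ lookup ⁅ v ⁆ j ⟧) ⟩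
  ∑[ v < N ] ⟦ lookup ⁅ v ⁆ i ⟧ + ∑[ v < N ] ⟦ lookup ⁅ v ⁆ j ⟧
    ≡⟨ cong₂ _+_ (∑-lookup-⁅⁆ i) (∑-lookup-⁅⁆ j) ⟩
  2 ∎
  where
  open ≡-Reasoning
  ⟦∨⟧ : ∀ a b → (a ≡ true → b ≢ true) → ⟦ a ∨ b ⟧ ≡ ⟦ a ⟧ + ⟦ b ⟧
  ⟦∨⟧ true true both = contradiction refl (both refl)
  ⟦∨⟧ true false _ = refl
  ⟦∨⟧ false b _ = refl
  not-both : ∀ v → lookup ⁅ v ⁆ i ≡ true → lookup ⁅ v ⁆ j ≢ true
  not-both v hitᵢ hitⱼ = i≢j (trans (lookup-⁅⁆ v i hitᵢ) (sym (lookup-⁅⁆ v j hitⱼ)))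

∣p∣+n≡N⇒∣∁p∣≡n : (p : Subset N) {n : ℕ} → ∣ p ∣ + n ≡ N → ∣ ∁ p ∣ ≡ n
∣p∣+n≡N⇒∣∁p∣≡n p {n} size = trans (∣∁p∣≡n∸∣p∣ p) (trans (cong (_∸ ∣ p ∣) (sym size)) (m+n∸m≡n ∣ p ∣ n))

∣p∪⁅x⁆∣ : (p : Subset N) {x : Fin N} → x ∉ p → ∣ p ∪ ⁅ x ⁆ ∣ ≡ suc ∣ p ∣
∣p∪⁅x⁆∣ (inside ∷ p) {zero} x∉p = contradiction here x∉p
∣p∪⁅x⁆∣ (outside ∷ p) {zero} x∉p = cong (λ q → suc ∣ q ∣) (∪-identityʳ p)
∣p∪⁅x⁆∣ (inside ∷ p) {suc x} x∉p = cong suc (∣p∪⁅x⁆∣ p (x∉p ∘ there))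
∣p∪⁅x⁆∣ (outside ∷ p) {suc x} x∉p = ∣p∪⁅x⁆∣ p (x∉p ∘ there)

handshake : (q : Pair N → Bool) (L : List (Pair N)) → Loopless L →
  ∑[ v < N ] count (λ e → q e ∧ meets ⁅ v ⁆ e) L ≡ 2 * count q L
handshake {N} q [] _ = sum-replicate-zero N
handshake {N} q (e ∷ L) (loopless All.∷ L-loopless) = begin
  ∑[ v < N ] (⟦ q e ∧ meets ⁅ v ⁆ e ⟧ + count (λ e → q e ∧ meets ⁅ v ⁆ e) L)
    ≡⟨ ∑-distrib-+ (λ v → ⟦ q e ∧ meets ⁅ v ⁆ e ⟧) (λ v → count (λ e → q e ∧ meets ⁅ v ⁆ e) L) ⟩
  ∑[ v < N ] ⟦ q e ∧ meets ⁅ v ⁆ e ⟧ + ∑[ v < N ] count (λ e → q e ∧ meets ⁅ v ⁆ e) L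
    ≡⟨ cong₂ _+_ (edge (q e)) (handshake q L L-loopless) ⟩
  2 * ⟦ q e ⟧ + 2 * count q L
    ≡⟨ *-distribˡ-+ 2 ⟦ q e ⟧ (count q L) ⟨
  2 * (⟦ q e ⟧ + count q L) ∎
  where
  open ≡-Reasoning
  edge : ∀ b → ∑[ v < N ] ⟦ b ∧ meets ⁅ v ⁆ e ⟧ ≡ 2 * ⟦ b ⟧
  edge true = ∑-meets-⁅⁆ loopless
  edge false = sum-replicate-zero N

-- Deleting a vertex of at least average degree d ≥ 2 (d + r) / n from a graph with d + r edges
-- on n vertices does not increase the ratio of edges to n (n - 1).
density-after-removal : ∀ c d r n → c * (d + r) ≤ n * (n ∸ 1) → 2 * (d + r) ≤ n * d →
  c * r ≤ (n ∸ 1) * (n ∸ 2)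
density-after-removal c d r 0 dense _ = ≤-trans (*-monoʳ-≤ c (m≤n+m r d)) dense
density-after-removal c d r 1 dense _ = ≤-trans (*-monoʳ-≤ c (m≤n+m r d)) dense
density-after-removal c d r (suc (suc m)) dense high = *-cancelʳ-≤ (c * r) (suc m * m) (2 + m) (begin
  c * r * (2 + m)      ≤⟨ +-cancelʳ-≤ (c * (2 * (d + r))) _ _ removal ⟩
  c * (d + r) * m      ≤⟨ *-monoˡ-≤ m dense ⟩
  (2 + m) * suc m * m  ≡⟨ rotate (2 + m) (suc m) m ⟩
  suc m * m * (2 + m)  ∎)
  where
  open ≤-Reasoning
  rotate : ∀ a b c → a * b * c ≡ b * c * a
  rotate = solve-∀
  regroup : ∀ c d r m → c * r * (2 + m) + c * ((2 + m) * d) ≡ c * (d + r) * m + c * (2 * (d + r))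
  regroup = solve-∀
  removal : c * r * (2 + m) + c * (2 * (d + r)) ≤ c * (d + r) * m + c * (2 * (d + r))
  removal = begin
    c * r * (2 + m) + c * (2 * (d + r))  ≤⟨ +-monoʳ-≤ (c * r * (2 + m)) (*-monoʳ-≤ c high) ⟩
    c * r * (2 + m) + c * ((2 + m) * d)  ≡⟨ regroup c d r m ⟩
    c * (d + r) * m + c * (2 * (d + r))  ∎

2*nC2 : ∀ n → 2 * (n C 2) ≡ n * (n ∸ 1)
2*nC2 zero = refl
2*nC2 (suc n) = begin
  2 * (suc n C 2)            ≡⟨ cong (2 *_) (nCk+nC[k+1]≡[n+1]C[k+1] n 1) ⟨
  2 * (n C 1 + n C 2)        ≡⟨ *-distribˡ-+ 2 (n C 1) (n C 2) ⟩
  2 * (n C 1) + 2 * (n C 2)  ≡⟨ cong₂ _+_ (cong (2 *_) (nC1≡n n)) (2*nC2 n) ⟩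
  2 * n + n * (n ∸ 1)        ≡⟨ step n ⟩
  suc n * n                  ∎
  where
  open ≡-Reasoning
  step : ∀ n → 2 * n + n * (n ∸ 1) ≡ suc n * n
  step zero = refl
  step (suc n) = identity n
    where
    identity : ∀ n → 2 * suc n + suc n * n ≡ suc (suc n) * suc n
    identity = solve-∀

ceil/4-≤ : ∀ {x h} → x ≤ 4 * h → ceil/4 x ≤ h
ceil/4-≤ {x} {h} x≤4h = ≤-pred (m<n*o⇒m/o<n (begin-strict
  x + 3      ≤⟨ +-monoˡ-≤ 3 x≤4h ⟩
  4 * h + 3  <⟨ +-monoʳ-< (4 * h) (n<1+n 3) ⟩
  4 * h + 4  ≡⟨ +-comm (4 * h) 4 ⟩
  4 + 4 * h  ≡⟨ *-suc 4 h ⟨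
  4 * suc h  ≡⟨ *-comm 4 (suc h) ⟩
  suc h * 4  ∎))
  where open ≤-Reasoning

meeting-pairs : ∀ k b → 2 * k * (k + b) ∸ (k * k + k) + b * (b ∸ 1) ≡ (k + b) * (k + b ∸ 1)
meeting-pairs zero b = refl
meeting-pairs (suc k) zero = begin
  2 * n * (n + 0) ∸ (n * n + n) + 0  ≡⟨ +-identityʳ _ ⟩
  2 * n * (n + 0) ∸ (n * n + n)      ≡⟨ cong (λ m → 2 * n * m ∸ (n * n + n)) (+-identityʳ n) ⟩
  2 * n * n ∸ (n * n + n)            ≡⟨ cong (_∸ (n * n + n)) (expand k) ⟩
  (n * n + n) + n * k ∸ (n * n + n)  ≡⟨ m+n∸m≡n (n * n + n) (n * k) ⟩
  n * (n ∸ 1)                        ≡⟨ cong (λ m → m * (m ∸ 1)) (+-identityʳ n) ⟨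
  (n + 0) * (n + 0 ∸ 1)              ∎
  where
  open ≡-Reasoning
  n = suc k
  expand : ∀ k → 2 * suc k * suc k ≡ (suc k * suc k + suc k) + suc k * k
  expand = solve-∀
meeting-pairs k (suc b) rewrite +-suc k b = begin
  2 * k * suc (k + b) ∸ (k * k + k) + suc b * b
    ≡⟨ cong (λ x → x ∸ (k * k + k) + suc b * b) (expand k b) ⟩
  (k * k + k) + (k * k + 2 * k * b + k) ∸ (k * k + k) + suc b * b
    ≡⟨ cong (_+ suc b * b) (m+n∸m≡n (k * k + k) _) ⟩
  (k * k + 2 * k * b + k) + suc b * b
    ≡⟨ collect k b ⟩
  suc (k + b) * (k + b) ∎
  where
  open ≡-Reasoning
  expand : ∀ k b → 2 * k * suc (k + b) ≡ (k * k + k) + (k * k + 2 * k * b + k)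
  expand = solve-∀
  collect : ∀ k b → (k * k + 2 * k * b + k) + suc b * b ≡ suc (k + b) * (k + b)
  collect = solve-∀

hit-bound : ∀ {N k h u} → k ≤ N → 4 * (h + u) ≡ N * (N ∸ 1) → 4 * u ≤ (N ∸ k) * (N ∸ k ∸ 1) →
  ceil/4 (2 * k * N ∸ (k * k + k)) ≤ h
hit-bound {N} {k} {h} {u} k≤N total few = ceil/4-≤ (+-cancelʳ-≤ (b * (b ∸ 1)) _ _ (begin
  2 * k * N ∸ (k * k + k) + b * (b ∸ 1)  ≡⟨ subst (λ n → 2 * k * n ∸ (k * k + k) + b * (b ∸ 1) ≡ n * (n ∸ 1))
                                                  (m+[n∸m]≡n k≤N) (meeting-pairs k b) ⟩
  N * (N ∸ 1)                            ≡⟨ total ⟨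
  4 * (h + u)                            ≡⟨ *-distribˡ-+ 4 h u ⟩
  4 * h + 4 * u                          ≤⟨ +-monoʳ-≤ (4 * h) few ⟩
  4 * h + b * (b ∸ 1)                    ∎))
  where
  open ≤-Reasoning
  b = N ∸ k

module Greedy (H : List (Pair N)) (loopless : Loopless H) where

  uncovered : Subset N → ℕ
  uncovered S = count (not ∘ meets S) H

  uncoveredDegree : Subset N → Fin N → ℕ
  uncoveredDegree S v = count (λ e → not (meets S e) ∧ meets ⁅ v ⁆ e) H

  hitCount+uncovered : (S : Subset N) → hitCount S H + uncovered S ≡ length H
  hitCount+uncovered S =
    trans (cong (_+ uncovered S) (length-filterᵇ (meets S) H)) (count-complement (meets S) H)

  uncovered-⊥ : uncovered ⊥ ≡ length H
  uncovered-⊥ = trans (count-cong (cong not ∘ meets-⊥) H) (count-true H)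

  uncovered-∪⁅⁆ : (S : Subset N) (v : Fin N) →
    uncoveredDegree S v + uncovered (S ∪ ⁅ v ⁆) ≡ uncovered S
  uncovered-∪⁅⁆ S v = trans (cong (uncoveredDegree S v +_) (count-cong not-∪ H))
                            (count-∧-split (not ∘ meets S) (meets ⁅ v ⁆) H)
    where
    not-∪ : ∀ e → not (meets (S ∪ ⁅ v ⁆) e) ≡ not (meets S e) ∧ not (meets ⁅ v ⁆ e)
    not-∪ e rewrite meets-∪ S ⁅ v ⁆ e with meets S e
    ... | true = refl
    ... | false = refl

  uncoveredDegree-∈ : (S : Subset N) {v : Fin N} → v ∈ S → uncoveredDegree S v ≡ 0
  uncoveredDegree-∈ S {v} v∈S = trans (count-cong vanish H) (count-false H)
    where
    ⁅v⁆⊆S : ⁅ v ⁆ ⊆ S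
    ⁅v⁆⊆S w∈⁅v⁆ = subst (_∈ S) (sym (x∈⁅y⁆⇒x≡y v w∈⁅v⁆)) v∈S
    vanish : ∀ e → not (meets S e) ∧ meets ⁅ v ⁆ e ≡ false
    vanish e with meets ⁅ v ⁆ e in hit
    ... | true rewrite meets-mono ⁅v⁆⊆S e hit = refl
    ... | false = ∧-zeroʳ _

  high-degree-vertex : (S : Subset N) {n : ℕ} → ∣ S ∣ + suc n ≡ N →
    Σ[ v ∈ Fin N ] v ∉ S × 2 * uncovered S ≤ suc n * uncoveredDegree S v
  high-degree-vertex S {n} size
    with ∃-above-average (∁ S) (uncoveredDegree S) (∣p∣≡1+n⇒Nonempty (∣p∣+n≡N⇒∣∁p∣≡n S size))
                         (uncoveredDegree-∈ S ∘ x∉∁p⇒x∈p)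
  ... | v , v∈∁S , aboveAverage =
    v , x∈∁p⇒x∉p v∈∁S ,
    subst₂ _≤_ (handshake (not ∘ meets S) H loopless)
           (cong (_* uncoveredDegree S v) (∣p∣+n≡N⇒∣∁p∣≡n S size)) aboveAverage

  greedy-step : (c : ℕ) (S : Subset N) {n : ℕ} → ∣ S ∣ + suc n ≡ N →
    c * uncovered S ≤ suc n * n →
    Σ[ S′ ∈ Subset N ] ∣ S′ ∣ ≡ suc ∣ S ∣ × c * uncovered S′ ≤ n * (n ∸ 1)
  greedy-step c S {n} size dense with high-degree-vertex S size
  ... | v , v∉S , high =
    S ∪ ⁅ v ⁆ , ∣p∪⁅x⁆∣ S v∉S ,
    density-after-removal c (uncoveredDegree S v) (uncovered (S ∪ ⁅ v ⁆)) (suc n)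
      (subst (λ r → c * r ≤ suc n * n) (sym split) dense)
      (subst (λ r → 2 * r ≤ suc n * uncoveredDegree S v) (sym split) high)
    where split = uncovered-∪⁅⁆ S v

  greedy : (c j n : ℕ) (S : Subset N) → ∣ S ∣ + n ≡ N → j ≤ n → c * uncovered S ≤ n * (n ∸ 1) →
    Σ[ S′ ∈ Subset N ] ∣ S′ ∣ ≡ j + ∣ S ∣ × c * uncovered S′ ≤ (n ∸ j) * (n ∸ j ∸ 1)
  greedy c zero n S _ _ dense = S , refl , dense
  greedy c (suc j) (suc n) S size (s≤s j≤n) dense with greedy-step c S size dense
  ... | S′ , ∣S′∣≡1+∣S∣ , dense′
    with greedy c j n S′ (trans (cong (_+ n) ∣S′∣≡1+∣S∣) (trans (sym (+-suc ∣ S ∣ n)) size)) j≤n dense′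
  ... | S″ , ∣S″∣≡j+∣S′∣ , sparse =
    S″ , trans ∣S″∣≡j+∣S′∣ (trans (cong (j +_) ∣S′∣≡1+∣S∣) (+-suc j ∣ S ∣)) , sparse

  greedy-cover : (c k : ℕ) → k ≤ N → c * length H ≤ N * (N ∸ 1) →
    Σ[ S ∈ Subset N ] ∣ S ∣ ≡ k × c * uncovered S ≤ (N ∸ k) * (N ∸ k ∸ 1)
  greedy-cover c k k≤N dense
    with greedy c k N ⊥ (cong (_+ N) (∣⊥∣≡0 N)) k≤N
                (subst (λ r → c * r ≤ N * (N ∸ 1)) (sym uncovered-⊥) dense)
  ... | S , ∣S∣≡k+∣⊥∣ , sparse =
    S , trans ∣S∣≡k+∣⊥∣ (trans (cong (k +_) (∣⊥∣≡0 N)) (+-identityʳ k)) , sparse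

mainTheorem2 : (N : ℕ) → 2 ≤ N →
    (H : List (Pair N)) →
    All (λ e → proj₁ e <ᶠ proj₂ e) H →
    Unique H →
    2 * length H ≡ N C 2 →
    Σ (Subset N) λ S →
      (∣ S ∣ ≡ ⌊ N /2⌋) ×
      (ceil/4 (2 * ⌊ N /2⌋ * N ∸ (⌊ N /2⌋ * ⌊ N /2⌋ + ⌊ N /2⌋)) ≤ hitCount S H)
mainTheorem2 N _ H ordered _ half =
  let S , ∣S∣≡k , sparse = greedy-cover 4 ⌊ N /2⌋ (⌊n/2⌋≤n N) (≤-reflexive 4∣H∣≡N[N∸1])
  in S , ∣S∣≡k , hit-bound (⌊n/2⌋≤n N) (trans (cong (4 *_) (hitCount+uncovered S)) 4∣H∣≡N[N∸1]) sparse
  where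
  open Greedy H (All.map <ᶠ⇒≢ ordered)
  4∣H∣≡N[N∸1] : 4 * length H ≡ N * (N ∸ 1)
  4∣H∣≡N[N∸1] = trans (*-assoc 2 2 (length H)) (trans (cong (2 *_) half) (2*nC2 N))
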